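{- Let $(Y_i)_{i\ge0}$ be a lazy simple symmetric random walk and $A_k=\sum_{i=1}^k Y_i$. For all integers $-n\le k\le k'\le n$, \[ \mathbb{P}(A_1,\dots,A_n\ge 0\mid Y_n=k)\le \mathbb{P}(A_1,\dots,A_n\ge 0\mid Y_n=k'). \]
   Context: A lazy simple symmetric random walk is $Y_0=0$, $Y_k=\sum_{i=1}^k X_i$ with $X_i$ i.i.d., $\mathbb{P}(X_i=\pm1)=1/4$, $\mathbb{P}(X_i=0)=1/2$. -}

module Defs where

open import Data.Bool using (Bool; true; false; if_then_else_; _∧_)
open import Data.Nat using (ℕ; zero; suc)
open import Data.Integer as ℤ using (ℤ; +_; -[1+_])
import Data.Integer.Properties as ℤP
open import Data.List using (List; []; _∷_; map; concatMap; foldr)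
open import Data.List.Relation.Unary.All using (All)
open import Data.List.Relation.Unary.All using (all?)
open import Data.Rational as ℚ using (ℚ; 0ℚ; 1ℚ; _÷_; ≢-nonZero)
open import Data.Rational.Properties using (_≟_)
open import Relation.Nullary using (does; yes; no)

data Step : Set where
  down stay up : Step

stepVal : Step → ℤ
stepVal down = -[1+ 0 ]
stepVal stay = + 0
stepVal up   = + 1

stepProb : Step → ℚ
stepProb down = + 1 ℚ./ 4
stepProb stay = + 1 ℚ./ 2
stepProb up   = + 1 ℚ./ 4

paths : ℕ → List (List Step)
paths zero    = [] ∷ []
paths (suc n) = concatMap (λ p → (down ∷ p) ∷ (stay ∷ p) ∷ (up ∷ p) ∷ []) (paths n)

pathProb : List Step → ℚ
pathProb = foldr (λ s q → stepProb s ℚ.* q) 1ℚ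

Prob : ℕ → (List Step → Bool) → ℚ
Prob n E = foldr (λ p q → (if E p then pathProb p else 0ℚ) ℚ.+ q) 0ℚ (paths n)

-- Conditional probability P(E | B); convention: 0 when P(B) = 0.
CondProb : ℕ → (List Step → Bool) → (List Step → Bool) → ℚ
CondProb n E B with Prob n B ≟ 0ℚ
... | yes _  = 0ℚ
... | no pB≢0 = _÷_ (Prob n (λ p → E p ∧ B p)) (Prob n B) {{≢-nonZero pB≢0}}

partialSums : ℤ → List ℤ → List ℤ
partialSums y []       = []
partialSums y (x ∷ xs) = (y ℤ.+ x) ∷ partialSums (y ℤ.+ x) xs

Ys : List Step → List ℤ
Ys p = partialSums (+ 0) (map stepVal p)

As : List Step → List ℤ
As p = partialSums (+ 0) (Ys p)

endpoint : List Step → ℤ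
endpoint p = foldr ℤ._+_ (+ 0) (map stepVal p)

AllAnonneg : List Step → Bool
AllAnonneg p = does (all? (λ a → + 0 ℤ.≤? a) (As p))

EndsAt : ℤ → List Step → Bool
EndsAt k p = does (endpoint p ℤ.≟ k)

-- Raising one step of a path (down ↦ stay or stay ↦ up) turns a path
-- with Y_n = k into one with Y_n = k + 1, and it can only increase every Y_i and every A_i,
-- so it preserves the event {A_1, …, A_n ≥ 0}.  Give the raise the weight of the likelier of
-- the two paths: down ↦ stay doubles the probability and stay ↦ up halves it.  Then a path p
-- sends out total weight (2·#down + #stay)·P(p) = (n − k)·P(p), and a path p′ receives
-- (#stay + 2·#up)·P(p′) = (n + k + 1)·P(p′).  Summing over all raises gives
--   (n − k)·P(Y_n = k) = (n + k + 1)·P(Y_n = k + 1),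
-- and summing only over raises leaving the good event gives
--   (n − k)·P(A ≥ 0, Y_n = k) ≤ (n + k + 1)·P(A ≥ 0, Y_n = k + 1).
-- Dividing proves the inequality for k′ = k + 1, and the general case follows by chaining.
module Submission where

open import Data.Bool using (Bool; true; false; if_then_else_; T; _∧_)
open import Data.Bool.Properties using (T-∧)
open import Data.Empty using (⊥-elim)
open import Data.Integer as ℤ using (ℤ; +_; -_; 1ℤ; ∣_∣) renaming (suc to sucℤ)
import Data.Integer.Properties as ℤ
import Data.Integer.Solver as ℤSolver
open import Data.List using (List; []; _∷_; _++_; foldr; map; concatMap; length)
open import Data.List.Relation.Binary.Pointwise as Pointwise using (Pointwise; []; _∷_)
open import Data.List.Relation.Unary.All as All using (All; []; _∷_; all?)
open import Data.List.Relation.Unary.All.Properties using (concat⁺; map⁺)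
open import Data.Nat using (ℕ; zero; suc)
open import Data.Nat.ListAction using (sum)
open import Data.Product using (_,_; proj₂)
open import Data.Rational as ℚ using (ℚ; 0ℚ; 1ℚ; _+_; _*_; _÷_; _≤_; Positive; NonZero)
import Data.Rational.Properties as ℚ
open import Data.Rational.Properties using (_≟_)
open import Data.Rational.Solver using (module +-*-Solver)
open import Algebra.Properties.Monoid.Mult ℚ.+-0-monoid using (_×_; ×-homo-+)
open import Function using (_∘_; mk⇔; Equivalence)
open import Relation.Binary.PropositionalEquality
open import Relation.Nullary using (Dec; yes; no; does; contradiction)
open import Relation.Nullary.Decidable using (does-⇔)

open import Defs

open ≡-Reasoning

∑ : {A : Set} → List A → (A → ℚ) → ℚ
∑ xs f = foldr (λ x s → f x + s) 0ℚ xs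

syntax ∑ xs (λ x → e) = ∑[ x ∈ xs ] e

module _ {A : Set} where

  ∑-cong : ∀ {f g : A → ℚ} xs → (∀ x → f x ≡ g x) → ∑ xs f ≡ ∑ xs g
  ∑-cong []       f≗g = refl
  ∑-cong (x ∷ xs) f≗g = cong₂ _+_ (f≗g x) (∑-cong xs f≗g)

  ∑-congᴬ : ∀ {f g : A → ℚ} {xs} → All (λ x → f x ≡ g x) xs → ∑ xs f ≡ ∑ xs g
  ∑-congᴬ []             = refl
  ∑-congᴬ (fx≡gx ∷ f≗g) = cong₂ _+_ fx≡gx (∑-congᴬ f≗g)

  ∑-zero : ∀ (xs : List A) → ∑[ x ∈ xs ] 0ℚ ≡ 0ℚ
  ∑-zero []       = refl
  ∑-zero (x ∷ xs) = trans (ℚ.+-identityˡ (∑[ x ∈ xs ] 0ℚ)) (∑-zero xs)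

  ∑-++ : ∀ (f : A → ℚ) xs ys → ∑ (xs ++ ys) f ≡ ∑ xs f + ∑ ys f
  ∑-++ f []       ys = sym (ℚ.+-identityˡ _)
  ∑-++ f (x ∷ xs) ys = trans (cong (_+_ (f x)) (∑-++ f xs ys)) (sym (ℚ.+-assoc (f x) _ _))

  ∑-+ : ∀ (f g : A → ℚ) xs → ∑[ x ∈ xs ] (f x + g x) ≡ ∑ xs f + ∑ xs g
  ∑-+ f g []       = refl
  ∑-+ f g (x ∷ xs) = trans (cong (_+_ (f x + g x)) (∑-+ f g xs))
    (solve 4 (λ a b c d → (a :+ b) :+ (c :+ d) := (a :+ c) :+ (b :+ d)) refl
      (f x) (g x) (∑ xs f) (∑ xs g))
    where open +-*-Solver

  ∑-* : ∀ c (f : A → ℚ) xs → ∑[ x ∈ xs ] (c * f x) ≡ c * ∑ xs f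
  ∑-* c f []       = sym (ℚ.*-zeroʳ c)
  ∑-* c f (x ∷ xs) = trans (cong (_+_ (c * f x)) (∑-* c f xs)) (sym (ℚ.*-distribˡ-+ c (f x) _))

  ∑-nonNeg : ∀ {f : A → ℚ} xs → (∀ x → 0ℚ ≤ f x) → 0ℚ ≤ ∑ xs f
  ∑-nonNeg []       f≥0 = ℚ.≤-refl
  ∑-nonNeg (x ∷ xs) f≥0 = ℚ.+-mono-≤ (f≥0 x) (∑-nonNeg xs f≥0)

  ∑-concatMap : ∀ {B : Set} (f : A → ℚ) (g : B → List A) xs →
                ∑ (concatMap g xs) f ≡ ∑[ y ∈ xs ] ∑ (g y) f
  ∑-concatMap f g []       = refl
  ∑-concatMap f g (y ∷ ys) = trans (∑-++ f (g y) _) (cong (_+_ (∑ (g y) f)) (∑-concatMap f g ys))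

∑-comm : ∀ {A B : Set} (f : A → B → ℚ) xs ys →
         ∑[ x ∈ xs ] ∑[ y ∈ ys ] f x y ≡ ∑[ y ∈ ys ] ∑[ x ∈ xs ] f x y
∑-comm f []       ys = sym (∑-zero ys)
∑-comm f (x ∷ xs) ys = trans (cong (_+_ (∑ ys (f x))) (∑-comm f xs ys))
                             (sym (∑-+ (f x) (λ y → ∑[ x ∈ xs ] f x y) ys))

*-nonNeg : ∀ {a b} → 0ℚ ≤ a → 0ℚ ≤ b → 0ℚ ≤ a * b
*-nonNeg {a} {b} 0≤a 0≤b =
  ℚ.nonNegative⁻¹ _ {{ℚ.nonNeg*nonNeg⇒nonNeg a {{ℚ.nonNegative 0≤a}} b {{ℚ.nonNegative 0≤b}}}}

×1ℚ-nonNeg : ∀ m → 0ℚ ≤ m × 1ℚ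
×1ℚ-nonNeg zero    = ℚ.≤-refl
×1ℚ-nonNeg (suc m) = ℚ.+-mono-≤ (ℚ.nonNegative⁻¹ 1ℚ) (×1ℚ-nonNeg m)

×1ℚ-pos : ∀ {m} → m ≢ 0 → Positive (m × 1ℚ)
×1ℚ-pos {zero}  m≢0 = contradiction refl m≢0
×1ℚ-pos {suc m} _   = ℚ.pos+nonNeg⇒pos 1ℚ (m × 1ℚ) {{ℚ.nonNegative (×1ℚ-nonNeg m)}}

÷-*-cancel : ∀ x a N .{{_ : NonZero N}} → (x ÷ N) * (a * N) ≡ a * x
÷-*-cancel x a N = begin
  (x ÷ N) * (a * N)        ≡⟨ solve 4 (λ x a N i → (x :* i) :* (a :* N) := (a :* x) :* (i :* N))
                                     refl x a N (ℚ.1/ N) ⟩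
  (a * x) * (ℚ.1/ N * N)   ≡⟨ cong (_*_ (a * x)) (ℚ.*-inverseˡ N) ⟩
  (a * x) * 1ℚ             ≡⟨ ℚ.*-identityʳ (a * x) ⟩
  a * x                    ∎
  where open +-*-Solver

÷-mono-balanced : ∀ {a b g g′ N N′} .{{_ : NonZero N}} .{{_ : NonZero N′}} .{{_ : Positive (a * N)}} →
                  a * N ≡ b * N′ → a * g ≤ b * g′ → g ÷ N ≤ g′ ÷ N′
÷-mono-balanced {a} {b} {g} {g′} {N} {N′} aN≡bN′ ag≤bg′ = ℚ.*-cancelʳ-≤-pos (a * N)
  (subst₂ _≤_ (sym (÷-*-cancel g a N))
              (sym (trans (cong (_*_ (g′ ÷ N′)) aN≡bN′) (÷-*-cancel g′ b N′)))
              ag≤bg′)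

sucℤ-injective : ∀ {i j} → sucℤ i ≡ sucℤ j → i ≡ j
sucℤ-injective {i} {j} eq = trans (sym (ℤ.pred-suc i)) (trans (cong ℤ.pred eq) (ℤ.pred-suc j))

∣n-k∣≢0 : ∀ {n k} → k ℤ.< + n → ∣ + n ℤ.- k ∣ ≢ 0
∣n-k∣≢0 {n} {k} k<n ∣n-k∣≡0 = ℤ.<-irrefl (sym (ℤ.i-j≡0⇒i≡j (+ n) k (ℤ.∣i∣≡0⇒i≡0 ∣n-k∣≡0))) k<n

≤-by-successors : ∀ (f : ℤ → ℚ) {hi} → (∀ {j} → sucℤ j ℤ.≤ hi → f j ≤ f (sucℤ j)) →
                  ∀ {k k′} → k ℤ.≤ k′ → k′ ℤ.≤ hi → f k ≤ f k′
≤-by-successors f {hi} step {k} {k′} k≤k′ k′≤hi =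
  subst (λ j → f k ≤ f j) d+k≡k′ (up-to ∣ k′ ℤ.- k ∣ (subst (ℤ._≤ hi) (sym d+k≡k′) k′≤hi))
  where
  up-to : ∀ d → + d ℤ.+ k ℤ.≤ hi → f k ≤ f (+ d ℤ.+ k)
  up-to zero    _  = subst (λ j → f k ≤ f j) (sym (ℤ.+-identityˡ k)) ℚ.≤-refl
  up-to (suc d) le = ℚ.≤-trans (up-to d (ℤ.≤-trans (ℤ.i≤suc[i] _) le′))
                               (subst (λ j → f (+ d ℤ.+ k) ≤ f j) (sym shift) (step le′))
    where
    shift : + suc d ℤ.+ k ≡ sucℤ (+ d ℤ.+ k)
    shift = ℤ.+-assoc 1ℤ (+ d) k
    le′ = subst (ℤ._≤ hi) shift le
  d+k≡k′ : + ∣ k′ ℤ.- k ∣ ℤ.+ k ≡ k′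
  d+k≡k′ = trans (cong (ℤ._+ k) (ℤ.0≤i⇒+∣i∣≡i (ℤ.i≤j⇒0≤j-i k≤k′)))
                 (solve 2 (λ k′ k → (k′ :- k) :+ k := k′) refl k′ k)
    where open ℤSolver.+-*-Solver

does⇒ : ∀ {A : Set} (a? : Dec A) → T (does a?) → A
does⇒ (yes a) _ = a

does-mono : ∀ {A B : Set} → (A → B) → (a? : Dec A) (b? : Dec B) → T (does a?) → T (does b?)
does-mono f (yes a) (yes b) _ = _
does-mono f (yes a) (no ¬b) _ = ¬b (f a)

if-mono-≤ : ∀ {a b} → (T a → T b) → ∀ {x} → 0ℚ ≤ x → (if a then x else 0ℚ) ≤ (if b then x else 0ℚ)
if-mono-≤ {true}  {true}  _   _   = ℚ.≤-refl
if-mono-≤ {true}  {false} a⇒b _   = ⊥-elim (a⇒b _)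
if-mono-≤ {false} {true}  _   0≤x = 0≤x
if-mono-≤ {false} {false} _   _   = ℚ.≤-refl

steps : List Step
steps = down ∷ stay ∷ up ∷ []

∑-paths-suc : ∀ n (f : List Step → ℚ) →
              ∑ (paths (suc n)) f ≡ ∑[ q ∈ paths n ] ∑[ s ∈ steps ] f (s ∷ q)
∑-paths-suc n f = ∑-concatMap f _ (paths n)

paths-length : ∀ n → All (λ p → length p ≡ n) (paths n)
paths-length zero    = refl ∷ []
paths-length (suc n) = concat⁺ (map⁺
  (All.map (λ p≡n → cong suc p≡n ∷ cong suc p≡n ∷ cong suc p≡n ∷ []) (paths-length n)))

stepProb-nonNeg : ∀ s → 0ℚ ≤ stepProb s
stepProb-nonNeg down = ℚ.nonNegative⁻¹ _
stepProb-nonNeg stay = ℚ.nonNegative⁻¹ _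
stepProb-nonNeg up   = ℚ.nonNegative⁻¹ _

pathProb-nonNeg : ∀ p → 0ℚ ≤ pathProb p
pathProb-nonNeg []      = ℚ.nonNegative⁻¹ 1ℚ
pathProb-nonNeg (s ∷ p) = *-nonNeg (stepProb-nonNeg s) (pathProb-nonNeg p)

probOn : (List Step → Bool) → List Step → ℚ
probOn E p = if E p then pathProb p else 0ℚ

probOn-nonNeg : ∀ E p → 0ℚ ≤ probOn E p
probOn-nonNeg E p with E p
... | true  = pathProb-nonNeg p
... | false = ℚ.≤-refl

probOn-∷ : ∀ E s q → probOn E (s ∷ q) ≡ stepProb s * probOn (E ∘ (s ∷_)) q
probOn-∷ E s q with E (s ∷ q)
... | true  = refl
... | false = sym (ℚ.*-zeroʳ (stepProb s))

Prob-nonNeg : ∀ n E → 0ℚ ≤ Prob n E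
Prob-nonNeg n E = ∑-nonNeg (paths n) (probOn-nonNeg E)

Prob-pos : ∀ n B → Prob n B ≢ 0ℚ → Positive (Prob n B)
Prob-pos n B B≢0 =
  ℚ.nonNeg∧nonZero⇒pos (Prob n B) {{ℚ.nonNegative (Prob-nonNeg n B)}} {{ℚ.≢-nonZero B≢0}}

CondProb-nonNeg : ∀ n E B → 0ℚ ≤ CondProb n E B
CondProb-nonNeg n E B with Prob n B ≟ 0ℚ
... | yes _   = ℚ.≤-refl
... | no B≢0 = *-nonNeg (Prob-nonNeg n (λ p → E p ∧ B p))
  (ℚ.<⇒≤ (ℚ.positive⁻¹ _ {{ℚ.1/pos⇒pos (Prob n B) {{Prob-pos n B B≢0}}}}))

expectOn : ℕ → (List Step → ℚ) → (List Step → Bool) → ℚ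
expectOn n W E = ∑[ p ∈ paths n ] (W p * probOn E p)

expectOn-const : ∀ n (W : List Step → ℚ) E c → (∀ p → length p ≡ n → T (E p) → W p ≡ c) →
                 expectOn n W E ≡ c * Prob n E
expectOn-const n W E c W≡c =
  trans (∑-congᴬ (All.map pointwise (paths-length n))) (∑-* c (probOn E) (paths n))
  where
  pointwise : ∀ {p} → length p ≡ n → W p * probOn E p ≡ c * probOn E p
  pointwise {p} p≡n with E p | W≡c p p≡n
  ... | true  | W≡c′ = cong (_* pathProb p) (W≡c′ _)
  ... | false | _    = trans (ℚ.*-zeroʳ (W p)) (sym (ℚ.*-zeroʳ c))

stepCount : (Step → ℕ) → List Step → ℚ
stepCount w p = sum (map w p) × 1ℚ

stepSum-endpoint : ∀ (w : Step → ℕ) c → (∀ s → + w s ≡ 1ℤ ℤ.+ c ℤ.* stepVal s) →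
                   ∀ p → + sum (map w p) ≡ + length p ℤ.+ c ℤ.* endpoint p
stepSum-endpoint w c w≡ []      = sym (trans (ℤ.+-identityˡ _) (ℤ.*-zeroʳ c))
stepSum-endpoint w c w≡ (s ∷ p) = begin
  + w s ℤ.+ + sum (map w p)
    ≡⟨ cong₂ ℤ._+_ (w≡ s) (stepSum-endpoint w c w≡ p) ⟩
  (1ℤ ℤ.+ c ℤ.* stepVal s) ℤ.+ (+ length p ℤ.+ c ℤ.* endpoint p)
    ≡⟨ solve 4 (λ c v l e → (con 1ℤ :+ c :* v) :+ (l :+ c :* e) := (con 1ℤ :+ l) :+ c :* (v :+ e))
             refl c (stepVal s) (+ length p) (endpoint p) ⟩
  + length (s ∷ p) ℤ.+ c ℤ.* endpoint (s ∷ p) ∎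
  where open ℤSolver.+-*-Solver

expectOn-zero : ∀ w E → expectOn 0 (stepCount w) E ≡ 0ℚ
expectOn-zero w E = trans (ℚ.+-identityʳ (0ℚ * probOn E [])) (ℚ.*-zeroˡ (probOn E []))

expectOn-suc : ∀ n w E →
  expectOn (suc n) (stepCount w) E ≡
    ∑[ q ∈ paths n ] ∑[ s ∈ steps ] ((w s × 1ℚ) * (stepProb s * probOn (E ∘ (s ∷_)) q))
    + ∑[ s ∈ steps ] (stepProb s * expectOn n (stepCount w) (E ∘ (s ∷_)))
expectOn-suc n w E = begin
  expectOn (suc n) W E
    ≡⟨ ∑-paths-suc n (λ p → W p * probOn E p) ⟩
  ∑[ q ∈ paths n ] ∑[ s ∈ steps ] (W (s ∷ q) * probOn E (s ∷ q))
    ≡⟨ ∑-cong (paths n) (λ q → ∑-cong steps (λ s → split s q)) ⟩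
  ∑[ q ∈ paths n ] ∑[ s ∈ steps ] (first s q + stepProb s * rest s q)
    ≡⟨ ∑-cong (paths n) (λ q → ∑-+ (λ s → first s q) (λ s → stepProb s * rest s q) steps) ⟩
  ∑[ q ∈ paths n ] (∑[ s ∈ steps ] first s q + ∑[ s ∈ steps ] (stepProb s * rest s q))
    ≡⟨ ∑-+ (λ q → ∑[ s ∈ steps ] first s q) (λ q → ∑[ s ∈ steps ] (stepProb s * rest s q)) (paths n) ⟩
  firsts + ∑[ q ∈ paths n ] ∑[ s ∈ steps ] (stepProb s * rest s q)
    ≡⟨ cong (_+_ firsts) (∑-comm (λ q s → stepProb s * rest s q) (paths n) steps) ⟩
  firsts + ∑[ s ∈ steps ] ∑[ q ∈ paths n ] (stepProb s * rest s q)
    ≡⟨ cong (_+_ firsts) (∑-cong steps (λ s → ∑-* (stepProb s) (rest s) (paths n))) ⟩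
  firsts + ∑[ s ∈ steps ] (stepProb s * expectOn n W (E ∘ (s ∷_))) ∎
  where
  W = stepCount w
  first rest : Step → List Step → ℚ
  first s q = (w s × 1ℚ) * (stepProb s * probOn (E ∘ (s ∷_)) q)
  rest s q = W q * probOn (E ∘ (s ∷_)) q
  firsts : ℚ
  firsts = ∑[ q ∈ paths n ] ∑[ s ∈ steps ] first s q
  split : ∀ s q → W (s ∷ q) * probOn E (s ∷ q) ≡ first s q + stepProb s * rest s q
  split s q = begin
    W (s ∷ q) * probOn E (s ∷ q)
      ≡⟨ cong₂ _*_ (×-homo-+ 1ℚ (w s) (sum (map w q))) (probOn-∷ E s q) ⟩
    (w s × 1ℚ + W q) * (stepProb s * probOn (E ∘ (s ∷_)) q)
      ≡⟨ solve 4 (λ a b c e → (a :+ b) :* (c :* e) := a :* (c :* e) :+ c :* (b :* e))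
               refl (w s × 1ℚ) (W q) (stepProb s) (probOn (E ∘ (s ∷_)) q) ⟩
    first s q + stepProb s * rest s q ∎
    where open +-*-Solver

data _↑_ : Step → Step → Set where
  down↑stay : down ↑ stay
  stay↑up   : stay ↑ up

data _⇑_ : List Step → List Step → Set where
  here  : ∀ {s s′ p} → s ↑ s′ → (s ∷ p) ⇑ (s′ ∷ p)
  there : ∀ {s p p′} → p ⇑ p′ → (s ∷ p) ⇑ (s ∷ p′)

stepVal-↑ : ∀ {s s′} → s ↑ s′ → stepVal s′ ≡ sucℤ (stepVal s)
stepVal-↑ down↑stay = refl
stepVal-↑ stay↑up   = refl

endpoint-⇑ : ∀ {p p′} → p ⇑ p′ → endpoint p′ ≡ sucℤ (endpoint p)
endpoint-⇑ {s ∷ p} (here s↑s′) =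
  trans (cong (ℤ._+ endpoint p) (stepVal-↑ s↑s′)) (ℤ.+-assoc 1ℤ (stepVal s) (endpoint p))
endpoint-⇑ {s ∷ p} {s ∷ p′} (there p⇑p′) = begin
  stepVal s ℤ.+ endpoint p′         ≡⟨ cong (ℤ._+_ (stepVal s)) (endpoint-⇑ p⇑p′) ⟩
  stepVal s ℤ.+ (1ℤ ℤ.+ endpoint p) ≡⟨ sym (ℤ.+-assoc (stepVal s) 1ℤ (endpoint p)) ⟩
  (stepVal s ℤ.+ 1ℤ) ℤ.+ endpoint p ≡⟨ cong (ℤ._+ endpoint p) (ℤ.+-comm (stepVal s) 1ℤ) ⟩
  (1ℤ ℤ.+ stepVal s) ℤ.+ endpoint p ≡⟨ ℤ.+-assoc 1ℤ (stepVal s) (endpoint p) ⟩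
  sucℤ (endpoint (s ∷ p))           ∎

EndsAt-⇑ : ∀ k {p p′} → p ⇑ p′ → EndsAt k p ≡ EndsAt (sucℤ k) p′
EndsAt-⇑ k {p} {p′} p⇑p′ = does-⇔
  (mk⇔ (λ p↦k → trans (endpoint-⇑ p⇑p′) (cong sucℤ p↦k))
       (λ p′↦k+1 → sucℤ-injective (trans (sym (endpoint-⇑ p⇑p′)) p′↦k+1)))
  (endpoint p ℤ.≟ k) (endpoint p′ ℤ.≟ sucℤ k)

stepVals-⇑ : ∀ {p p′} → p ⇑ p′ → Pointwise ℤ._≤_ (map stepVal p) (map stepVal p′)
stepVals-⇑ {s ∷ p} (here s↑s′) =
  subst (stepVal s ℤ.≤_) (sym (stepVal-↑ s↑s′)) (ℤ.i≤suc[i] (stepVal s)) ∷ Pointwise.refl ℤ.≤-refl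
stepVals-⇑ (there p⇑p′) = ℤ.≤-refl ∷ stepVals-⇑ p⇑p′

partialSums-mono : ∀ {y y′ xs xs′} → y ℤ.≤ y′ → Pointwise ℤ._≤_ xs xs′ →
                   Pointwise ℤ._≤_ (partialSums y xs) (partialSums y′ xs′)
partialSums-mono y≤y′ []              = []
partialSums-mono y≤y′ (x≤x′ ∷ xs≤xs′) =
  ℤ.+-mono-≤ y≤y′ x≤x′ ∷ partialSums-mono (ℤ.+-mono-≤ y≤y′ x≤x′) xs≤xs′

As-⇑ : ∀ {p p′} → p ⇑ p′ → Pointwise ℤ._≤_ (As p) (As p′)
As-⇑ p⇑p′ = partialSums-mono ℤ.≤-refl (partialSums-mono ℤ.≤-refl (stepVals-⇑ p⇑p′))

AllAnonneg-⇑ : ∀ {p p′} → p ⇑ p′ → T (AllAnonneg p) → T (AllAnonneg p′)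
AllAnonneg-⇑ p⇑p′ = does-mono
  (Pointwise.All-resp-Pointwise (λ a≤b 0≤a → ℤ.≤-trans 0≤a a≤b) (As-⇑ p⇑p′))
  (all? _ _) (all? _ _)

Good : ℤ → List Step → Bool
Good k p = AllAnonneg p ∧ EndsAt k p

Good-⇑ : ∀ k {p p′} → p ⇑ p′ → T (Good k p) → T (Good (sucℤ k) p′)
Good-⇑ k p⇑p′ good = let (p≥0 , p↦k) = Equivalence.to T-∧ good in
  Equivalence.from T-∧ (AllAnonneg-⇑ p⇑p′ p≥0 , subst T (EndsAt-⇑ k p⇑p′) p↦k)

raiseWeight lowerWeight : Step → ℕ
raiseWeight down = 2
raiseWeight stay = 1
raiseWeight up   = 0
lowerWeight down = 0
lowerWeight stay = 1
lowerWeight up   = 2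

½ : ℚ
½ = + 1 ℚ./ 2

raise-firsts : ∀ (f : Step → ℚ) →
  ∑[ s ∈ steps ] ((raiseWeight s × 1ℚ) * (stepProb s * f s)) ≡ ½ * f down + ½ * f stay
raise-firsts f = solve 3 (λ x y z →
    con (2 × 1ℚ) :* (con (stepProb down) :* x)
      :+ (con (1 × 1ℚ) :* (con (stepProb stay) :* y) :+ (con (0 × 1ℚ) :* (con (stepProb up) :* z) :+ con 0ℚ))
    := con ½ :* x :+ con ½ :* y)
  refl (f down) (f stay) (f up)
  where open +-*-Solver

lower-firsts : ∀ (f : Step → ℚ) →
  ∑[ s ∈ steps ] ((lowerWeight s × 1ℚ) * (stepProb s * f s)) ≡ ½ * f stay + ½ * f up
lower-firsts f = solve 3 (λ x y z →
    con (0 × 1ℚ) :* (con (stepProb down) :* x)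
      :+ (con (1 × 1ℚ) :* (con (stepProb stay) :* y) :+ (con (2 × 1ℚ) :* (con (stepProb up) :* z) :+ con 0ℚ))
    := con ½ :* y :+ con ½ :* z)
  refl (f down) (f stay) (f up)
  where open +-*-Solver

module Switching
  (_⊑_ : ℚ → ℚ → Set)
  (⊑-refl : ∀ {a} → a ⊑ a)
  (+-mono-⊑ : ∀ {a b c d} → a ⊑ b → c ⊑ d → (a + c) ⊑ (b + d))
  (*-mono-⊑ : ∀ c → 0ℚ ≤ c → ∀ {a b} → a ⊑ b → (c * a) ⊑ (c * b))
  where

  ∑-mono : ∀ {A : Set} {f g : A → ℚ} xs → (∀ x → f x ⊑ g x) → ∑ xs f ⊑ ∑ xs g
  ∑-mono []       f⊑g = ⊑-refl
  ∑-mono (x ∷ xs) f⊑g = +-mono-⊑ (f⊑g x) (∑-mono xs f⊑g)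

  RaiseMonotone : (E G : List Step → Bool) → Set
  RaiseMonotone E G =
    ∀ {p p′} → p ⇑ p′ → ∀ {x} → 0ℚ ≤ x → (if E p then x else 0ℚ) ⊑ (if G p′ then x else 0ℚ)

  switching : ∀ n {E G} → RaiseMonotone E G →
              expectOn n (stepCount raiseWeight) E ⊑ expectOn n (stepCount lowerWeight) G
  switching zero {E} {G} _ =
    subst₂ _⊑_ (sym (expectOn-zero raiseWeight E)) (sym (expectOn-zero lowerWeight G)) ⊑-refl
  switching (suc n) {E} {G} mono =
    subst₂ _⊑_ (sym (expectOn-suc n raiseWeight E)) (sym (expectOn-suc n lowerWeight G))
      (+-mono-⊑ (∑-mono (paths n) firsts) (∑-mono steps rests))
    where
    firsts : ∀ q → (∑[ s ∈ steps ] ((raiseWeight s × 1ℚ) * (stepProb s * probOn (E ∘ (s ∷_)) q)))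
                 ⊑ (∑[ s ∈ steps ] ((lowerWeight s × 1ℚ) * (stepProb s * probOn (G ∘ (s ∷_)) q)))
    firsts q = subst₂ _⊑_ (sym (raise-firsts (λ s → probOn (E ∘ (s ∷_)) q)))
                          (sym (lower-firsts (λ s → probOn (G ∘ (s ∷_)) q)))
      (+-mono-⊑ (*-mono-⊑ ½ (ℚ.nonNegative⁻¹ ½) (mono (here {p = q} down↑stay) (pathProb-nonNeg q)))
                (*-mono-⊑ ½ (ℚ.nonNegative⁻¹ ½) (mono (here {p = q} stay↑up) (pathProb-nonNeg q))))
    rests : ∀ s → (stepProb s * expectOn n (stepCount raiseWeight) (E ∘ (s ∷_)))
                ⊑ (stepProb s * expectOn n (stepCount lowerWeight) (G ∘ (s ∷_)))
    rests s = *-mono-⊑ (stepProb s) (stepProb-nonNeg s) (switching n (mono ∘ there))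

module ≤-Switching = Switching _≤_ ℚ.≤-refl ℚ.+-mono-≤
  (λ c 0≤c → ℚ.*-monoˡ-≤-nonNeg c {{ℚ.nonNegative 0≤c}})
module ≡-Switching = Switching _≡_ refl (cong₂ _+_) (λ c _ → cong (_*_ c))

raiseCountAt lowerCountAt : ℕ → ℤ → ℚ
raiseCountAt n k = ∣ + n ℤ.- k ∣ × 1ℚ
lowerCountAt n k = ∣ + n ℤ.+ k ∣ × 1ℚ

expect-raise : ∀ n k E → (∀ p → T (E p) → T (EndsAt k p)) →
               expectOn n (stepCount raiseWeight) E ≡ raiseCountAt n k * Prob n E
expect-raise n k E E⊆k = expectOn-const n (stepCount raiseWeight) E (raiseCountAt n k) λ where
  p refl Ep → cong (λ m → ∣ m ∣ × 1ℚ) (begin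
    + sum (map raiseWeight p)           ≡⟨ stepSum-endpoint raiseWeight ℤ.-1ℤ
                                             (λ { down → refl ; stay → refl ; up → refl }) p ⟩
    + length p ℤ.+ ℤ.-1ℤ ℤ.* endpoint p ≡⟨ cong (ℤ._+_ (+ length p)) (ℤ.-1*i≡-i (endpoint p)) ⟩
    + length p ℤ.- endpoint p           ≡⟨ cong (ℤ._-_ (+ length p)) (does⇒ (endpoint p ℤ.≟ k) (E⊆k p Ep)) ⟩
    + length p ℤ.- k                    ∎)

expect-lower : ∀ n k E → (∀ p → T (E p) → T (EndsAt k p)) →
               expectOn n (stepCount lowerWeight) E ≡ lowerCountAt n k * Prob n E
expect-lower n k E E⊆k = expectOn-const n (stepCount lowerWeight) E (lowerCountAt n k) λ where
  p refl Ep → cong (λ m → ∣ m ∣ × 1ℚ) (begin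
    + sum (map lowerWeight p)           ≡⟨ stepSum-endpoint lowerWeight 1ℤ
                                             (λ { down → refl ; stay → refl ; up → refl }) p ⟩
    + length p ℤ.+ 1ℤ ℤ.* endpoint p    ≡⟨ cong (ℤ._+_ (+ length p)) (ℤ.*-identityˡ (endpoint p)) ⟩
    + length p ℤ.+ endpoint p           ≡⟨ cong (ℤ._+_ (+ length p)) (does⇒ (endpoint p ℤ.≟ k) (E⊆k p Ep)) ⟩
    + length p ℤ.+ k                    ∎)

ends-balance : ∀ n k → raiseCountAt n k * Prob n (EndsAt k)
                     ≡ lowerCountAt n (sucℤ k) * Prob n (EndsAt (sucℤ k))
ends-balance n k = begin
  raiseCountAt n k * Prob n (EndsAt k)
    ≡⟨ sym (expect-raise n k (EndsAt k) (λ _ p↦k → p↦k)) ⟩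
  expectOn n (stepCount raiseWeight) (EndsAt k)
    ≡⟨ ≡-Switching.switching n (λ p⇑p′ _ → cong (λ b → if b then _ else 0ℚ) (EndsAt-⇑ k p⇑p′)) ⟩
  expectOn n (stepCount lowerWeight) (EndsAt (sucℤ k))
    ≡⟨ expect-lower n (sucℤ k) (EndsAt (sucℤ k)) (λ _ p↦k+1 → p↦k+1) ⟩
  lowerCountAt n (sucℤ k) * Prob n (EndsAt (sucℤ k)) ∎

good-balance : ∀ n k → raiseCountAt n k * Prob n (Good k) ≤ lowerCountAt n (sucℤ k) * Prob n (Good (sucℤ k))
good-balance n k = subst₂ _≤_
  (expect-raise n k (Good k) (λ p → proj₂ ∘ Equivalence.to T-∧))
  (expect-lower n (sucℤ k) (Good (sucℤ k)) (λ p → proj₂ ∘ Equivalence.to T-∧))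
  (≤-Switching.switching n (λ p⇑p′ → if-mono-≤ (Good-⇑ k p⇑p′)))

raiseCountAt*Prob-pos : ∀ n k → k ℤ.< + n → Prob n (EndsAt k) ≢ 0ℚ →
                        Positive (raiseCountAt n k * Prob n (EndsAt k))
raiseCountAt*Prob-pos n k k<n N≢0 = ℚ.pos*pos⇒pos
  (raiseCountAt n k) {{×1ℚ-pos (∣n-k∣≢0 k<n)}} (Prob n (EndsAt k)) {{Prob-pos n (EndsAt k) N≢0}}

CondProb-step : ∀ n k → k ℤ.< + n →
  CondProb n AllAnonneg (EndsAt k) ≤ CondProb n AllAnonneg (EndsAt (sucℤ k))
CondProb-step n k k<n with Prob n (EndsAt k) ≟ 0ℚ
... | yes _   = CondProb-nonNeg n AllAnonneg (EndsAt (sucℤ k))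
... | no N≢0 with Prob n (EndsAt (sucℤ k)) ≟ 0ℚ
...   | yes N′≡0 = ⊥-elim (ℚ.<-irrefl (sym aN≡0) (ℚ.positive⁻¹ _ {{raiseCountAt*Prob-pos n k k<n N≢0}}))
  where
  aN≡0 = trans (ends-balance n k)
               (trans (cong (_*_ (lowerCountAt n (sucℤ k))) N′≡0) (ℚ.*-zeroʳ (lowerCountAt n (sucℤ k))))
...   | no N′≢0 = ÷-mono-balanced {raiseCountAt n k} {lowerCountAt n (sucℤ k)}
                    {{ℚ.≢-nonZero N≢0}} {{ℚ.≢-nonZero N′≢0}} {{raiseCountAt*Prob-pos n k k<n N≢0}}
                    (ends-balance n k) (good-balance n k)

lemma4p1 : (n : ℕ) (k k′ : ℤ) → - (+ n) ℤ.≤ k → k ℤ.≤ k′ → k′ ℤ.≤ + n →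
    CondProb n AllAnonneg (EndsAt k) ≤ CondProb n AllAnonneg (EndsAt k′)
lemma4p1 n k k′ _ = ≤-by-successors (λ j → CondProb n AllAnonneg (EndsAt j))
  (λ j+1≤n → CondProb-step n _ (ℤ.suc[i]≤j⇒i<j j+1≤n))
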